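{- For integers $k\ge 2$ and $0\le j\le k-1$, \[ B_{k,j}=2\sum_{p=0}^{k-j-1}(-1)^{k+j+1}\binom{j+p-1}{j-1}\left(\frac{k-1}{2}\right)^p s_{k-1,j+p}. \]
   Context: The Stirling numbers of the first kind $s_{n,m}$ ($n\ge 1$, $0\le m\le n$) are defined by $x(x+1)\cdots(x+n-1)=\sum_{m=0}^{n}(-1)^{n+m}s_{n,m}x^m$. For integers $k\ge 2$ and $0\le j\le k-1$, \[ B_{k,j}=\sum_{p=0}^{k-j-1}(-1)^{k+j+1}\binom{j+p}{j}\left(\frac{k-1}{2}\right)^p\left(s_{k,j+p+1}+s_{k-1,j+p}\right). \] Binomial coefficients $\binom{a}{b}$ with integer $b<0$ are taken to be $0$. -}

module Defs where

open import Data.Nat using (ℕ; zero; suc; _∸_) renaming (_+_ to _+ℕ_; _*_ to _*ℕ_)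
open import Data.Nat.Combinatorics using (_C_)
open import Data.Integer using (+_)
open import Data.Rational using (ℚ; _/_; _+_; _*_; -_; 0ℚ; 1ℚ)

-- Unsigned Stirling numbers of the first kind c n m:  x(x+1)...(x+n-1) = Σ_m c n m x^m.
-- Recurrence: s(0,0)=1, s(n+1,0)=0, s(0,m+1)=0, s(n+1,m+1) = s(n,m) + n s(n,m+1).
stirling1 : ℕ → ℕ → ℕ
stirling1 zero    zero    = 1
stirling1 zero    (suc m) = 0
stirling1 (suc n) zero    = 0
stirling1 (suc n) (suc m) = stirling1 n m +ℕ n *ℕ stirling1 n (suc m)

ℕ→ℚ : ℕ → ℚ
ℕ→ℚ n = + n / 1

sgn : ℕ → ℚ
sgn zero    = 1ℚ
sgn (suc n) = - sgn n

pow : ℚ → ℕ → ℚ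
pow q zero    = 1ℚ
pow q (suc n) = q * pow q n

-- The paper's (signed) Stirling numbers s_{n,m}, defined by
-- x(x+1)...(x+n-1) = Σ_m (-1)^{n+m} s_{n,m} x^m, i.e. s_{n,m} = (-1)^{n+m} c(n,m).
s : ℕ → ℕ → ℚ
s n m = sgn (n +ℕ m) * ℕ→ℚ (stirling1 n m)

sumUpTo : ℕ → (ℕ → ℚ) → ℚ
sumUpTo zero    f = 0ℚ
sumUpTo (suc n) f = sumUpTo n f + f n

-- binom(j+p-1, j-1) with the convention that binom(a,b)=0 for b<0 (i.e. j = 0)
binomShift : ℕ → ℕ → ℕ
binomShift zero     p = 0
binomShift (suc j') p = (j' +ℕ p) C j'

half : ℕ → ℚ
half k = + (k ∸ 1) / 2

B : ℕ → ℕ → ℚ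
B k j = sumUpTo (k ∸ j) (λ p →
  sgn (k +ℕ j +ℕ 1) * ℕ→ℚ ((j +ℕ p) C j) * pow (half k) p
    * (s k (j +ℕ p +ℕ 1) + s (k ∸ 1) (j +ℕ p)))

RHS : ℕ → ℕ → ℚ
RHS k j = ℕ→ℚ 2 * sumUpTo (k ∸ j) (λ p →
  sgn (k +ℕ j +ℕ 1) * ℕ→ℚ (binomShift j p) * pow (half k) p
    * s (k ∸ 1) (j +ℕ p))

{-# OPTIONS --safe #-}
-- With h = (k-1)/2 the Stirling recurrence reads s_{k,q+1} + s_{k-1,q} = 2 (s_{k-1,q} - h s_{k-1,q+1}),
-- so B_{k,j} is twice a sum of C(j+p,j) h^p (T_{j+p} - h T_{j+p+1}) for the row T = s_{k-1,·}.
-- Shifting the index of the second half by one (Abel summation) turns the weight C(j+p,j) into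
-- C(j+p,j) - C(j+p-1,j) = C(j+p-1,j-1); the boundary terms vanish because T_0 = 0 and T_k = 0.
module Submission where

open import Data.Nat as ℕ using (ℕ; zero; suc; _≤_; _<_; _∸_; s≤s)
open import Data.Nat.Properties
  using (+-suc; +-comm; m<n⇒m<1+n; n<1+n; m≤n⇒m≤1+n; m+[n∸m]≡n)
  renaming (+-identityʳ to ℕ-+-identityʳ; *-zeroʳ to ℕ-*-zeroʳ)
open import Data.Nat.Combinatorics using (_C_; nCn≡1; nCk+nC[k+1]≡[n+1]C[k+1])
open import Data.Integer as ℤ using (+_)
open import Data.Integer.Properties as ℤ using (pos-+; pos-*)
open import Data.Rational using (ℚ; _+_; _*_; -_; _-_; 0ℚ; 1ℚ; toℚᵘ)
open import Data.Rational.Properties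
  using (toℚᵘ-injective; toℚᵘ-fromℚᵘ; toℚᵘ-homo-+; toℚᵘ-homo-*; +-identityʳ; *-zeroʳ)
import Data.Rational.Unnormalised as ℚᵘ
import Data.Rational.Unnormalised.Properties as ℚᵘ
open import Data.Rational.Solver using (module +-*-Solver)
open import Function using (_∘_)
open import Relation.Binary.PropositionalEquality
open import Defs

open +-*-Solver

toℚᵘ-ℕ→ℚ : ∀ n → toℚᵘ (ℕ→ℚ n) ℚᵘ.≃ ℚᵘ.mkℚᵘ (+ n) 0
toℚᵘ-ℕ→ℚ n = toℚᵘ-fromℚᵘ (ℚᵘ.mkℚᵘ (+ n) 0)

ℕ→ℚ-+ : ∀ a b → ℕ→ℚ (a ℕ.+ b) ≡ ℕ→ℚ a + ℕ→ℚ b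
ℕ→ℚ-+ a b = toℚᵘ-injective (begin
  toℚᵘ (ℕ→ℚ (a ℕ.+ b))               ≈⟨ toℚᵘ-ℕ→ℚ (a ℕ.+ b) ⟩
  ℚᵘ.mkℚᵘ (+ (a ℕ.+ b)) 0            ≈⟨ ℚᵘ.*≡* (cong (ℤ._* + 1) (trans (pos-+ a b)
                                          (sym (cong₂ ℤ._+_ (ℤ.*-identityʳ (+ a)) (ℤ.*-identityʳ (+ b)))))) ⟩
  ℚᵘ.mkℚᵘ (+ a) 0 ℚᵘ.+ ℚᵘ.mkℚᵘ (+ b) 0 ≈⟨ ℚᵘ.+-cong (toℚᵘ-ℕ→ℚ a) (toℚᵘ-ℕ→ℚ b) ⟨
  toℚᵘ (ℕ→ℚ a) ℚᵘ.+ toℚᵘ (ℕ→ℚ b)     ≈⟨ toℚᵘ-homo-+ (ℕ→ℚ a) (ℕ→ℚ b) ⟨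
  toℚᵘ (ℕ→ℚ a + ℕ→ℚ b)               ∎)
  where open ℚᵘ.≃-Reasoning

ℕ→ℚ-* : ∀ a b → ℕ→ℚ (a ℕ.* b) ≡ ℕ→ℚ a * ℕ→ℚ b
ℕ→ℚ-* a b = toℚᵘ-injective (begin
  toℚᵘ (ℕ→ℚ (a ℕ.* b))               ≈⟨ toℚᵘ-ℕ→ℚ (a ℕ.* b) ⟩
  ℚᵘ.mkℚᵘ (+ (a ℕ.* b)) 0            ≈⟨ ℚᵘ.*≡* (cong (ℤ._* + 1) (pos-* a b)) ⟩
  ℚᵘ.mkℚᵘ (+ a) 0 ℚᵘ.* ℚᵘ.mkℚᵘ (+ b) 0 ≈⟨ ℚᵘ.*-cong (toℚᵘ-ℕ→ℚ a) (toℚᵘ-ℕ→ℚ b) ⟨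
  toℚᵘ (ℕ→ℚ a) ℚᵘ.* toℚᵘ (ℕ→ℚ b)     ≈⟨ toℚᵘ-homo-* (ℕ→ℚ a) (ℕ→ℚ b) ⟨
  toℚᵘ (ℕ→ℚ a * ℕ→ℚ b)               ∎)
  where open ℚᵘ.≃-Reasoning

2*half[1+n]≡n : ∀ n → ℕ→ℚ 2 * half (suc n) ≡ ℕ→ℚ n
2*half[1+n]≡n n = toℚᵘ-injective (begin
  toℚᵘ (ℕ→ℚ 2 * half (suc n))             ≈⟨ toℚᵘ-homo-* (ℕ→ℚ 2) (half (suc n)) ⟩
  toℚᵘ (ℕ→ℚ 2) ℚᵘ.* toℚᵘ (half (suc n))  ≈⟨ ℚᵘ.*-cong (toℚᵘ-ℕ→ℚ 2) (toℚᵘ-fromℚᵘ (ℚᵘ.mkℚᵘ (+ n) 1)) ⟩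
  ℚᵘ.mkℚᵘ (+ 2) 0 ℚᵘ.* ℚᵘ.mkℚᵘ (+ n) 1   ≈⟨ ℚᵘ.*≡* (trans (ℤ.*-identityʳ (+ 2 ℤ.* + n)) (ℤ.*-comm (+ 2) (+ n))) ⟩
  ℚᵘ.mkℚᵘ (+ n) 0                         ≈⟨ toℚᵘ-ℕ→ℚ n ⟨
  toℚᵘ (ℕ→ℚ n)                            ∎)
  where open ℚᵘ.≃-Reasoning

open ≡-Reasoning

stirling1-vanishes : ∀ {n m} → n < m → stirling1 n m ≡ 0
stirling1-vanishes {zero}  {suc m} _         = refl
stirling1-vanishes {suc n} {suc m} (s≤s n<m)
  rewrite stirling1-vanishes n<m | stirling1-vanishes (m<n⇒m<1+n n<m) = ℕ-*-zeroʳ n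

s-vanishes : ∀ {n m} → n < m → s n m ≡ 0ℚ
s-vanishes {n} {m} n<m = trans (cong (λ c → sgn (n ℕ.+ m) * ℕ→ℚ c) (stirling1-vanishes n<m)) (*-zeroʳ (sgn (n ℕ.+ m)))

s-suc-zero : ∀ n → s (suc n) 0 ≡ 0ℚ
s-suc-zero n = *-zeroʳ (sgn (suc n ℕ.+ 0))

s-recurrence : ∀ n m → s (suc n) (suc m) ≡ s n m - ℕ→ℚ n * s n (suc m)
s-recurrence n m = begin
  sgn (suc n ℕ.+ suc m) * ℕ→ℚ (stirling1 n m ℕ.+ n ℕ.* stirling1 n (suc m))
    ≡⟨ cong₂ _*_ (cong (sgn ∘ suc) (+-suc n m))
                 (trans (ℕ→ℚ-+ (stirling1 n m) _) (cong (λ x → a + x) (ℕ→ℚ-* n (stirling1 n (suc m))))) ⟩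
  - (- σ) * (a + N * b)
    ≡⟨ solve 4 (λ σ a N b → (:- (:- σ)) :* (a :+ N :* b) := σ :* a :- N :* ((:- σ) :* b)) refl σ a N b ⟩
  σ * a - N * ((- σ) * b)
    ≡⟨ cong (λ τ → σ * a - N * (τ * b)) (cong sgn (sym (+-suc n m))) ⟩
  s n m - ℕ→ℚ n * s n (suc m) ∎
  where
  σ = sgn (n ℕ.+ m)
  a = ℕ→ℚ (stirling1 n m)
  b = ℕ→ℚ (stirling1 n (suc m))
  N = ℕ→ℚ n

s-suc-suc+s : ∀ n q → s (suc n) (suc q) + s n q ≡ ℕ→ℚ 2 * (s n q - half (suc n) * s n (suc q))
s-suc-suc+s n q = begin
  s (suc n) (suc q) + s n q                    ≡⟨ cong (_+ s n q) (s-recurrence n q) ⟩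
  s n q - ℕ→ℚ n * s n (suc q) + s n q          ≡⟨ cong (λ N → s n q - N * s n (suc q) + s n q) (sym (2*half[1+n]≡n n)) ⟩
  s n q - ℕ→ℚ 2 * h * s n (suc q) + s n q
    ≡⟨ solve 3 (λ t h t′ → t :- (con 1ℚ :+ con 1ℚ) :* h :* t′ :+ t := (con 1ℚ :+ con 1ℚ) :* (t :- h :* t′)) refl (s n q) h (s n (suc q)) ⟩
  ℕ→ℚ 2 * (s n q - h * s n (suc q)) ∎
  where
  h = half (suc n)

sumUpTo-cong : ∀ n {f g : ℕ → ℚ} → (∀ p → f p ≡ g p) → sumUpTo n f ≡ sumUpTo n g
sumUpTo-cong zero    f≗g = refl
sumUpTo-cong (suc n) f≗g = cong₂ _+_ (sumUpTo-cong n f≗g) (f≗g n)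

sumUpTo-*ˡ : ∀ n c (f : ℕ → ℚ) → sumUpTo n (λ p → c * f p) ≡ c * sumUpTo n f
sumUpTo-*ˡ zero    c f = sym (*-zeroʳ c)
sumUpTo-*ˡ (suc n) c f = begin
  sumUpTo n (λ p → c * f p) + c * f n ≡⟨ cong (_+ c * f n) (sumUpTo-*ˡ n c f) ⟩
  c * sumUpTo n f + c * f n           ≡⟨ solve 3 (λ c S x → c :* S :+ c :* x := c :* (S :+ x)) refl c (sumUpTo n f) (f n) ⟩
  c * (sumUpTo n f + f n)             ∎

sumUpTo-telescope : ∀ n (f g : ℕ → ℚ) →
  sumUpTo n (λ p → f p - g (suc p)) ≡ sumUpTo n (λ p → f p - g p) + (g 0 - g n)
sumUpTo-telescope zero    f g = solve 1 (λ x → con 0ℚ := con 0ℚ :+ (x :- x)) refl (g 0)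
sumUpTo-telescope (suc n) f g = begin
  sumUpTo n (λ p → f p - g (suc p)) + (f n - g (suc n))
    ≡⟨ cong (_+ (f n - g (suc n))) (sumUpTo-telescope n f g) ⟩
  S + (g 0 - g n) + (f n - g (suc n))
    ≡⟨ solve 5 (λ S g₀ gₙ fₙ gₙ₊₁ → S :+ (g₀ :- gₙ) :+ (fₙ :- gₙ₊₁) := S :+ (fₙ :- gₙ) :+ (g₀ :- gₙ₊₁))
         refl S (g 0) (g n) (f n) (g (suc n)) ⟩
  S + (f n - g n) + (g 0 - g (suc n)) ∎
  where
  S = sumUpTo n (λ p → f p - g p)

module _ (c h : ℚ) (T : ℕ → ℚ) (T₀≡0 : T 0 ≡ 0ℚ) where
  private
    weighted : ℕ → ℕ → ℚ
    weighted j p = c * ℕ→ℚ ((j ℕ.+ p) C j) * pow h p * T (j ℕ.+ p)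

    -- c C(j+p-1, j) h^p T_{j+p}, with C(j-1, j) read as 0
    weighted′ : ℕ → ℕ → ℚ
    weighted′ j zero    = 0ℚ
    weighted′ j (suc p) = c * ℕ→ℚ ((j ℕ.+ p) C j) * pow h (suc p) * T (suc (j ℕ.+ p))

    weighted-pascal : ∀ j p → weighted j p - weighted′ j p ≡ c * ℕ→ℚ (binomShift j p) * pow h p * T (j ℕ.+ p)
    weighted-pascal zero zero rewrite T₀≡0 =
      solve 2 (λ c C → c :* C :* con 1ℚ :* con 0ℚ :- con 0ℚ := c :* con 0ℚ :* con 1ℚ :* con 0ℚ) refl c (ℕ→ℚ 1)
    weighted-pascal zero (suc p) =
      solve 3 (λ c P t → c :* con 1ℚ :* P :* t :- c :* con 1ℚ :* P :* t := c :* con 0ℚ :* P :* t)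
        refl c (pow h (suc p)) (T (suc p))
    weighted-pascal (suc j) zero rewrite ℕ-+-identityʳ j | nCn≡1 j | nCn≡1 (suc j) =
      solve 2 (λ c t → c :* con 1ℚ :* con 1ℚ :* t :- con 0ℚ := c :* con 1ℚ :* con 1ℚ :* t) refl c (T (suc j))
    weighted-pascal (suc j) (suc p) rewrite +-suc j p = begin
      c * ℕ→ℚ (suc r C suc j) * P * t - c * ℕ→ℚ (r C suc j) * P * t
        ≡⟨ cong (λ x → c * x * P * t - c * ℕ→ℚ (r C suc j) * P * t)
             (trans (cong ℕ→ℚ (sym (nCk+nC[k+1]≡[n+1]C[k+1] r j))) (ℕ→ℚ-+ (r C j) (r C suc j))) ⟩
      c * (ℕ→ℚ (r C j) + ℕ→ℚ (r C suc j)) * P * t - c * ℕ→ℚ (r C suc j) * P * t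
        ≡⟨ solve 5 (λ c a b P t → c :* (a :+ b) :* P :* t :- c :* b :* P :* t := c :* a :* P :* t)
             refl c (ℕ→ℚ (r C j)) (ℕ→ℚ (r C suc j)) P t ⟩
      c * ℕ→ℚ (r C j) * P * t ∎
      where
      r = suc (j ℕ.+ p)
      P = pow h (suc p)
      t = T (suc r)

    weighted′-vanishes : ∀ j L → T (j ℕ.+ L) ≡ 0ℚ → weighted′ j L ≡ 0ℚ
    weighted′-vanishes j zero    _         = refl
    weighted′-vanishes j (suc L) T[j+L]≡0 =
      trans (cong (x *_) (trans (cong T (sym (+-suc j L))) T[j+L]≡0)) (*-zeroʳ x)
      where x = c * ℕ→ℚ ((j ℕ.+ L) C j) * pow h (suc L)

  binomial-abel-sum : ∀ j L → T (j ℕ.+ L) ≡ 0ℚ →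
      sumUpTo L (λ p → c * ℕ→ℚ ((j ℕ.+ p) C j) * pow h p * (T (j ℕ.+ p) - h * T (suc (j ℕ.+ p))))
    ≡ sumUpTo L (λ p → c * ℕ→ℚ (binomShift j p) * pow h p * T (j ℕ.+ p))
  binomial-abel-sum j L T[j+L]≡0 = begin
    sumUpTo L (λ p → c * ℕ→ℚ ((j ℕ.+ p) C j) * pow h p * (T (j ℕ.+ p) - h * T (suc (j ℕ.+ p))))
      ≡⟨ sumUpTo-cong L (λ p →
           solve 6 (λ c h C P t t′ → c :* C :* P :* (t :- h :* t′) := c :* C :* P :* t :- c :* C :* (h :* P) :* t′)
             refl c h (ℕ→ℚ ((j ℕ.+ p) C j)) (pow h p) (T (j ℕ.+ p)) (T (suc (j ℕ.+ p)))) ⟩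
    sumUpTo L (λ p → weighted j p - weighted′ j (suc p))
      ≡⟨ sumUpTo-telescope L (weighted j) (weighted′ j) ⟩
    sumUpTo L (λ p → weighted j p - weighted′ j p) + (0ℚ - weighted′ j L)
      ≡⟨ cong (λ x → sumUpTo L (λ p → weighted j p - weighted′ j p) + (0ℚ - x)) (weighted′-vanishes j L T[j+L]≡0) ⟩
    sumUpTo L (λ p → weighted j p - weighted′ j p) + (0ℚ - 0ℚ)
      ≡⟨ +-identityʳ _ ⟩
    sumUpTo L (λ p → weighted j p - weighted′ j p)
      ≡⟨ sumUpTo-cong L (weighted-pascal j) ⟩
    sumUpTo L (λ p → c * ℕ→ℚ (binomShift j p) * pow h p * T (j ℕ.+ p)) ∎

lemma1 : (k j : ℕ) → 2 ≤ k → j ≤ k ∸ 1 → B k j ≡ RHS k j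
lemma1 k@(suc (suc n)) j (s≤s (s≤s _)) j≤k∸1 = begin
  B k j
    ≡⟨ sumUpTo-cong (k ∸ j) (λ p → halve (weight p) (j ℕ.+ p)) ⟩
  sumUpTo (k ∸ j) (λ p → ℕ→ℚ 2 * (weight p * (T (j ℕ.+ p) - h * T (suc (j ℕ.+ p)))))
    ≡⟨ sumUpTo-*ˡ (k ∸ j) (ℕ→ℚ 2) (λ p → weight p * (T (j ℕ.+ p) - h * T (suc (j ℕ.+ p)))) ⟩
  ℕ→ℚ 2 * sumUpTo (k ∸ j) (λ p → weight p * (T (j ℕ.+ p) - h * T (suc (j ℕ.+ p))))
    ≡⟨ cong (ℕ→ℚ 2 *_) (binomial-abel-sum σ h T (s-suc-zero n) j (k ∸ j) T[k]≡0) ⟩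
  RHS k j ∎
  where
  σ = sgn (k ℕ.+ j ℕ.+ 1)
  h = half k
  T = s (suc n)

  weight : ℕ → ℚ
  weight p = σ * ℕ→ℚ ((j ℕ.+ p) C j) * pow h p

  T[k]≡0 : T (j ℕ.+ (k ∸ j)) ≡ 0ℚ
  T[k]≡0 = trans (cong T (m+[n∸m]≡n (m≤n⇒m≤1+n j≤k∸1))) (s-vanishes (n<1+n (suc n)))

  halve : ∀ w q → w * (s k (q ℕ.+ 1) + T q) ≡ ℕ→ℚ 2 * (w * (T q - h * T (suc q)))
  halve w q = begin
    w * (s k (q ℕ.+ 1) + T q)                ≡⟨ cong (λ q′ → w * (s k q′ + T q)) (+-comm q 1) ⟩
    w * (s k (suc q) + T q)                  ≡⟨ cong (w *_) (s-suc-suc+s (suc n) q) ⟩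
    w * (ℕ→ℚ 2 * (T q - h * T (suc q)))
      ≡⟨ solve 3 (λ w two x → w :* (two :* x) := two :* (w :* x)) refl w (ℕ→ℚ 2) (T q - h * T (suc q)) ⟩
    ℕ→ℚ 2 * (w * (T q - h * T (suc q)))      ∎
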